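{- Let $\mathbb{E}$ be a c-semiring, $\Sigma$ a Component Action System, $I$ a finite nonempty index set and $(A_i)_{i\in I}$ a family of Soft Component Automata over $\Sigma$ and $\mathbb{E}$ with thresholds $(t_i)_{i\in I}$. Let $A = \bowtie_{i\in I} A_i$ and let $\sigma\in\Sigma^\pi$ be a behavior of $A$. Call $J\subseteq I$ suspect if $\bigotimes_{i\in J} t_i \le_{\mathbb{E}} d_A(\sigma)$ (with $\bigotimes\emptyset = \mathbf{1}$). Consider the recursive procedure $\mathtt{FindSuspect}(K)$ for $K\subseteq I$: set $M:=\emptyset$; for each $i\in K$, if $K\setminus\{i\}$ is suspect, set $M := M\cup \mathtt{FindSuspect}(K\setminus\{i\})$; finally, return $\{K\}$ if $M=\emptyset$ and return $M$ otherwise. If $I$ is suspect and $d_A(\sigma) <_{\mathbb{E}} \mathbf{1}$, then $\mathtt{FindSuspect}(I)$ consists exactly of the minimal (with respect to inclusion) suspect subsets of $I$.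
   Context: A c-semiring $\langle \mathbb{E},\bigoplus,\otimes,\mathbf{0},\mathbf{1}\rangle$: $\bigoplus:2^{\mathbb{E}}\to\mathbb{E}$ with $\bigoplus\emptyset=\mathbf{0}$, $\bigoplus\mathbb{E}=\mathbf{1}$, $\bigoplus\{e\}=e$, $\bigoplus\{\bigoplus E:E\in\mathcal{E}\}=\bigoplus\bigcup\mathcal{E}$; $\otimes$ commutative, associative, $e\otimes\mathbf{0}=\mathbf{0}$, $e\otimes\mathbf{1}=e$, $e\otimes\bigoplus E=\bigoplus\{e\otimes e':e'\in E\}$. Order: $e\le e'$ iff $\bigoplus\{e,e'\}=e'$ (a complete lattice; meet $\bigwedge$). A CAS $\langle\Sigma,\circledcirc,\boxdot\rangle$: finite $\Sigma$, reflexive symmetric composability relation $\circledcirc$, and an idempotent, commutative, associative partial composition $\boxdot$ defined on pairs in $\circledcirc$. An SCA $\langle Q,\Sigma,\mathbb{E},\rightarrow,q^0,t\rangle$: finite states $Q$, initial $q^0$, threshold $t$, finite $\rightarrow\subseteq Q\times\Sigma\times\mathbb{E}\times Q$. The composition $A_0\bowtie A_1$ of SCAs $\langle Q_j,\Sigma,\mathbb{E},\rightarrow_j,q^0_j,t_j\rangle$ has states $Q_0\times Q_1$, initial state $(q_0^0,q_1^0)$, threshold $t_0\otimes t_1$, and transitions $(q_0,q_1)\xrightarrow{a_0\boxdot a_1,\ e_0\otimes e_1}(q_0',q_1')$ whenever $q_0\xrightarrow{a_0,e_0}_0q_0'$, $q_1\xrightarrow{a_1,e_1}_1q_1'$ and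 $a_0\circledcirc a_1$; $\bowtie_{i\in I}$ is iterated composition. $L(A)$ is the set of $\sigma\in\Sigma^\omega$ admitting $\mu\in Q^\omega,\nu\in\mathbb{E}^\omega$ with $\mu(0)=q^0$, $t\le\nu(n)$ and $\mu(n)\xrightarrow{\sigma(n),\nu(n)}\mu(n+1)$ for all $n$. $\Sigma^\pi$: eventually periodic streams. Diagnostic preference of $\sigma$ in $A$ with initial state $q^0$: $Q_0=\{q^0\}$, $Q_{n+1}=\{q':q\in Q_n,q\xrightarrow{\sigma(n),e}q'\}$, $\xi(n)=\bigoplus\{e:q\in Q_n,q\xrightarrow{\sigma(n),e}q'\}$, $d_A(\sigma)=\bigwedge_n\xi(n)$. -}

module Defs where

open import Level using (0ℓ)
open import Data.Nat using (ℕ; zero; suc; _+_; _≤_; _>_)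
open import Data.Fin using (Fin; zero; suc)
open import Data.Fin.Subset using (Subset; inside; outside; _∈_; _⊆_; _-_; ∣_∣)
open import Data.Vec using ([]; _∷_)
open import Data.Bool using (true; false)
open import Data.Product using (Σ; _×_; _,_)
open import Data.Sum using (_⊎_)
open import Data.Empty using (⊥)
open import Data.Unit using (⊤)
open import Data.List using (List)
open import Data.List.Membership.Propositional using () renaming (_∈_ to _∈ₗ_)
open import Relation.Unary using (Pred)
open import Relation.Nullary using (¬_)
open import Relation.Binary.PropositionalEquality using (_≡_; _≢_)
open import Function using (_∘_)
open import Function.Bundles using (_↔_)

Finite : Set → Set
Finite X = Σ ℕ λ n → Fin n ↔ X

-- Sets of subsets 𝓔 are represented as (small) indexed families F : K → Pred E.

record CSemiring : Set₁ where
  infixl 7 _⊗_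
  field
    E   : Set
    ⨁   : Pred E 0ℓ → E
    _⊗_ : E → E → E
    𝟎   : E
    𝟏   : E
    ⨁-ext     : ∀ {P P' : Pred E 0ℓ} → (∀ x → P x → P' x) → (∀ x → P' x → P x) → ⨁ P ≡ ⨁ P'
    ⨁-empty   : ⨁ (λ _ → ⊥) ≡ 𝟎
    ⨁-full    : ⨁ (λ _ → ⊤) ≡ 𝟏
    ⨁-single  : ∀ e → ⨁ (λ x → x ≡ e) ≡ e
    ⨁-flatten : ∀ (K : Set) (F : K → Pred E 0ℓ) →
                ⨁ (λ x → Σ K λ k → ⨁ (F k) ≡ x) ≡ ⨁ (λ x → Σ K λ k → F k x)
    ⊗-comm    : ∀ e e' → e ⊗ e' ≡ e' ⊗ e
    ⊗-assoc   : ∀ e e' e'' → (e ⊗ e') ⊗ e'' ≡ e ⊗ (e' ⊗ e'')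
    ⊗-zero    : ∀ e → e ⊗ 𝟎 ≡ 𝟎
    ⊗-one     : ∀ e → e ⊗ 𝟏 ≡ e
    ⊗-distrib : ∀ e (P : Pred E 0ℓ) → e ⊗ ⨁ P ≡ ⨁ (λ x → Σ E λ e' → P e' × e ⊗ e' ≡ x)

  _≤ₑ_ : E → E → Set
  e ≤ₑ e' = ⨁ (λ x → x ≡ e ⊎ x ≡ e') ≡ e'

  _<ₑ_ : E → E → Set
  e <ₑ e' = e ≤ₑ e' × e ≢ e'

  ⋀ : Pred E 0ℓ → E
  ⋀ P = ⨁ (λ x → ∀ y → P y → x ≤ₑ y)

-- Component action systems.  The partial composition ⊡ is represented
-- by a total function whose values are only meaningful on ⊚-related pairs.

record CAS : Set₁ where
  field
    Act    : Set
    finite : Finite Act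
    _⊚_    : Act → Act → Set
    _⊡_    : Act → Act → Act
    ⊚-refl  : ∀ a → a ⊚ a
    ⊚-sym   : ∀ {a b} → a ⊚ b → b ⊚ a
    ⊡-idem  : ∀ a → a ⊡ a ≡ a
    ⊡-comm  : ∀ {a b} → a ⊚ b → a ⊡ b ≡ b ⊡ a
    ⊡-assocˡ : ∀ {a b c} → a ⊚ b → (a ⊡ b) ⊚ c → (b ⊚ c) × (a ⊚ (b ⊡ c))
    ⊡-assocʳ : ∀ {a b c} → b ⊚ c → a ⊚ (b ⊡ c) → (a ⊚ b) × ((a ⊡ b) ⊚ c)
    ⊡-assoc  : ∀ {a b c} → a ⊚ b → (a ⊡ b) ⊚ c → (a ⊡ b) ⊡ c ≡ a ⊡ (b ⊡ c)

module _ (S : CSemiring) (C : CAS) where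
  open CSemiring S
  open CAS C

  record SCA : Set₁ where
    field
      Q     : Set
      q0    : Q
      t     : E
      Trans : Q → Act → E → Q → Set

  FiniteSCA : SCA → Set
  FiniteSCA A = Finite Q × (Σ (List (Q × Act × E × Q)) λ L →
                  ∀ q a e q' → Trans q a e q' → (q , a , e , q') ∈ₗ L)
    where open SCA A

  _⋈_ : SCA → SCA → SCA
  A₀ ⋈ A₁ = record
    { Q  = A.Q × B.Q
    ; q0 = A.q0 , B.q0
    ; t  = A.t ⊗ B.t
    ; Trans = λ { (q₀ , q₁) a e (q₀' , q₁') →
        Σ Act λ a₀ → Σ Act λ a₁ → Σ E λ e₀ → Σ E λ e₁ →
          A.Trans q₀ a₀ e₀ q₀' × B.Trans q₁ a₁ e₁ q₁' × a₀ ⊚ a₁ ×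
          a ≡ a₀ ⊡ a₁ × e ≡ e₀ ⊗ e₁ } }
    where module A = SCA A₀
          module B = SCA A₁

  ⋈[_] : ∀ k → (Fin (suc k) → SCA) → SCA
  ⋈[ zero ]  A = A zero
  ⋈[ suc k ] A = A zero ⋈ ⋈[ k ] (A ∘ suc)

  Stream : Set
  Stream = ℕ → Act

  EventuallyPeriodic : Stream → Set
  EventuallyPeriodic σ = Σ ℕ λ n₀ → Σ ℕ λ p → p > 0 × (∀ n → n₀ ≤ n → σ (p + n) ≡ σ n)

  InL : SCA → Stream → Set
  InL A σ = Σ (ℕ → Q) λ μ → Σ (ℕ → E) λ ν → μ 0 ≡ q0 ×
              (∀ n → t ≤ₑ ν n × Trans (μ n) (σ n) (ν n) (μ (suc n)))
    where open SCA A

  module _ (A : SCA) (σ : Stream) where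
    open SCA A

    Reach : ℕ → Q → Set
    Reach zero    q  = q ≡ q0
    Reach (suc n) q' = Σ Q λ q → Σ E λ e → Reach n q × Trans q (σ n) e q'

    ξ : ℕ → E
    ξ n = ⨁ (λ e → Σ Q λ q → Σ Q λ q' → Reach n q × Trans q (σ n) e q')

    diag : E
    diag = ⋀ (λ y → Σ ℕ λ n → ξ n ≡ y)

  ⨂ : ∀ {n} → Subset n → (Fin n → E) → E
  ⨂ []           t = 𝟏
  ⨂ (true  ∷ J)  t = t zero ⊗ ⨂ J (t ∘ suc)
  ⨂ (false ∷ J)  t = ⨂ J (t ∘ suc)

  Suspect : ∀ k → (A : Fin (suc k) → SCA) → Stream → Subset (suc k) → Set
  Suspect k A σ J = ⨂ J (λ i → SCA.t (A i)) ≤ₑ diag (⋈[ k ] A) σ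

-- FindSuspect, as the set of subsets it returns (a predicate on subsets).
-- FS Susp f K J : "J ∈ FindSuspect(K)", computed with recursion fuel f;
-- the procedure is run with fuel ∣ K ∣, which is exactly the recursion depth.

FS : ∀ {n} → (Subset n → Set) → ℕ → Subset n → Subset n → Set
FS Susp zero    K J = J ≡ K
FS Susp (suc f) K J =
  (Σ (Fin _) λ i → i ∈ K × Susp (K - i) × FS Susp f (K - i) J)
  ⊎ (¬ (Σ (Fin _) λ i → Σ (Subset _) λ J' → i ∈ K × Susp (K - i) × FS Susp f (K - i) J')
     × J ≡ K)

FindSuspect : ∀ {n} → (Subset n → Set) → Subset n → Subset n → Set
FindSuspect Susp K J = FS Susp ∣ K ∣ K J

MinimalSuspect : ∀ {n} → (Subset n → Set) → Subset n → Set
MinimalSuspect Susp J = Susp J × (∀ J' → J' ⊆ J → Susp J' → J' ≡ J)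

module Submission where

-- The soft-automaton structure plays almost no role: the only property of
-- "suspect" that the argument uses is that it is upward closed, i.e. if
-- J ⊆ J' and J is suspect then so is J'.  This holds because the threshold
-- product ⨂_{i∈J} tᵢ can only decrease when factors are added, a consequence
-- of x ⊗ y ≤ y in every c-semiring.

open import Defs
open import Level using (0ℓ)
open import Data.Nat using (ℕ; zero; suc; _≤_)
import Data.Nat.Properties as ℕ
open import Data.Fin using (Fin; zero; suc)
open import Data.Fin.Subset using (Subset; ⊤; _∈_; _∉_; _⊆_; _⊂_; _-_; ∣_∣; ⁅_⁆)
open import Data.Fin.Subset.Properties
  using (_∈?_; _⊂?_; ⊆-refl; ⊆-trans; ⊆-antisym; ⊂-irref; ⊆⊤; drop-∷-⊆; p─q⊆p;
         x∈p∧x≢y⇒x∈p-y; x∈p⇒p-x⊂p; x∈p⇒∣p-x∣<∣p∣)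
open import Data.Vec using ([]; _∷_; here)
open import Data.Bool using (Bool; true; false)
open import Data.Product using (Σ; _×_; _,_; proj₁)
open import Data.Sum using (_⊎_; inj₁; inj₂)
open import Data.Empty using (⊥-elim)
import Data.Unit as Unit
open import Relation.Unary using (Pred)
open import Relation.Nullary using (¬_; yes; no)
open import Relation.Nullary.Decidable using (decidable-stable)
open import Relation.Binary.PropositionalEquality using (_≡_; refl; sym; trans; cong; cong₂; subst; module ≡-Reasoning)

module _ {n : ℕ} where

  -- Membership is decidable, so a subset of K is either K or a proper subset.
  ⊆⇒≡⊎⊂ : {J K : Subset n} → J ⊆ K → J ≡ K ⊎ J ⊂ K
  ⊆⇒≡⊎⊂ {J} {K} J⊆K with J ⊂? K
  ... | yes J⊂K = inj₂ J⊂K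
  ... | no  J⊄K = inj₁ (⊆-antisym J⊆K K⊆J)
    where
    K⊆J : K ⊆ J
    K⊆J {x} x∈K = decidable-stable (x ∈? J) (λ x∉J → J⊄K (J⊆K , x , x∈K , x∉J))

  ⊂⇒⊆- : {J K : Subset n} → J ⊂ K → Σ (Fin n) λ i → i ∈ K × J ⊆ K - i
  ⊂⇒⊆- (J⊆K , i , i∈K , i∉J) =
    i , i∈K , λ x∈J → x∈p∧x≢y⇒x∈p-y (J⊆K x∈J) (λ { refl → i∉J x∈J })

  ∣p∣≤0⇒x∉p : {K : Subset n} {i : Fin n} → ∣ K ∣ ≤ 0 → i ∉ K
  ∣p∣≤0⇒x∉p ∣K∣≤0 i∈K = ℕ.n≮0 (ℕ.≤-trans (x∈p⇒∣p-x∣<∣p∣ i∈K) ∣K∣≤0)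

  -- Removing an element lowers the size bound by one; this pays the fuel
  -- of the recursive calls of FindSuspect.
  ∣p-x∣≤f : {K : Subset n} {i : Fin n} {f : ℕ} → i ∈ K → ∣ K ∣ ≤ suc f → ∣ K - i ∣ ≤ f
  ∣p-x∣≤f i∈K ∣K∣≤1+f = ℕ.≤-pred (ℕ.≤-trans (x∈p⇒∣p-x∣<∣p∣ i∈K) ∣K∣≤1+f)

UpwardClosed : ∀ {n} → (Subset n → Set) → Set
UpwardClosed P = ∀ {J J'} → J ⊆ J' → P J → P J'

module FindSuspectCorrectness {n : ℕ} (Susp : Subset n → Set) (upward : UpwardClosed Susp) where

  Shrinkable : Subset n → Set
  Shrinkable K = Σ (Fin n) λ i → i ∈ K × Susp (K - i)

  minimal⇒¬shrinkable : ∀ {K} → MinimalSuspect Susp K → ¬ Shrinkable K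
  minimal⇒¬shrinkable {K} (_ , least) (i , i∈K , K-i-susp) =
    ⊂-irref (least (K - i) (p─q⊆p K ⁅ i ⁆) K-i-susp) (x∈p⇒p-x⊂p i∈K)

  -- Conversely, by upward closure a suspect proper subset of K yields a
  -- suspect K - i, so an unshrinkable suspect set is minimal.
  ¬shrinkable⇒minimal : ∀ {K} → Susp K → ¬ Shrinkable K → MinimalSuspect Susp K
  ¬shrinkable⇒minimal {K} K-susp ¬shrinkable = K-susp , least
    where
    least : ∀ J → J ⊆ K → Susp J → J ≡ K
    least J J⊆K J-susp with ⊆⇒≡⊎⊂ J⊆K
    ... | inj₁ J≡K = J≡K
    ... | inj₂ J⊂K with ⊂⇒⊆- J⊂K
    ...   | i , i∈K , J⊆K-i = ⊥-elim (¬shrinkable (i , i∈K , upward J⊆K-i J-susp))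

  -- FindSuspect never returns the empty collection: either some recursive
  -- call contributes, or K itself is returned.  (Which of the two happens is
  -- undecidable, hence the double negation.)
  FS-nonempty : ∀ f K → ¬ ¬ Σ (Subset n) (FS Susp f K)
  FS-nonempty zero    K none = none (K , refl)
  FS-nonempty (suc f) K none =
    none (K , inj₂ ((λ (i , J , i∈K , K-i-susp , fs) → none (J , inj₁ (i , i∈K , K-i-susp , fs))) , refl))

  sound : ∀ f K → ∣ K ∣ ≤ f → Susp K → ∀ {J} → FS Susp f K J → MinimalSuspect Susp J × J ⊆ K
  sound zero K ∣K∣≤0 K-susp refl =
    ¬shrinkable⇒minimal K-susp (λ (_ , i∈K , _) → ∣p∣≤0⇒x∉p ∣K∣≤0 i∈K) , ⊆-refl
  sound (suc f) K ∣K∣≤1+f _ (inj₁ (i , i∈K , K-i-susp , fs))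
    with sound f (K - i) (∣p-x∣≤f i∈K ∣K∣≤1+f) K-i-susp fs
  ... | J-minimal , J⊆K-i = J-minimal , ⊆-trans J⊆K-i (p─q⊆p K ⁅ i ⁆)
  sound (suc f) K _ K-susp (inj₂ (no-call , refl)) = ¬shrinkable⇒minimal K-susp ¬shrinkable , ⊆-refl
    where
    ¬shrinkable : ¬ Shrinkable K
    ¬shrinkable (i , i∈K , K-i-susp) =
      FS-nonempty f (K - i) (λ (J , fs) → no-call (i , J , i∈K , K-i-susp , fs))

  -- Completeness: every minimal suspect subset of K is returned; a proper one
  -- is found through the recursive call on a K - i containing it.
  complete : ∀ f K → ∣ K ∣ ≤ f → ∀ {J} → MinimalSuspect Susp J → J ⊆ K → FS Susp f K J
  complete f K ∣K∣≤f J-minimal J⊆K with ⊆⇒≡⊎⊂ J⊆K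
  complete zero    K _ _ _ | inj₁ refl = refl
  complete (suc f) K _ J-minimal _ | inj₁ refl =
    inj₂ ((λ (i , _ , i∈K , K-i-susp , _) → minimal⇒¬shrinkable J-minimal (i , i∈K , K-i-susp)) , refl)
  complete zero    K ∣K∣≤0 _ _ | inj₂ (_ , _ , i∈K , _) = ⊥-elim (∣p∣≤0⇒x∉p ∣K∣≤0 i∈K)
  complete (suc f) K ∣K∣≤1+f J-minimal _ | inj₂ J⊂K with ⊂⇒⊆- J⊂K
  ... | i , i∈K , J⊆K-i =
    inj₁ (i , i∈K , upward J⊆K-i (proj₁ J-minimal) ,
          complete f (K - i) (∣p-x∣≤f i∈K ∣K∣≤1+f) J-minimal J⊆K-i)

module CSemiringOrder (S : CSemiring) where
  open CSemiring S
  open ≡-Reasoning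

  pair : E → E → Pred E 0ℓ
  pair a b x = x ≡ a ⊎ x ≡ b

  singleton : E → Pred E 0ℓ
  singleton a x = x ≡ a

  ⨁-pair-⨁ : (P P' : Pred E 0ℓ) → ⨁ (pair (⨁ P) (⨁ P')) ≡ ⨁ (λ x → P x ⊎ P' x)
  ⨁-pair-⨁ P P' = trans (⨁-ext to-family from-family) (trans (⨁-flatten Bool F) (⨁-ext to-union from-union))
    where
    F : Bool → Pred E 0ℓ
    F true  = P
    F false = P'
    to-family : ∀ x → pair (⨁ P) (⨁ P') x → Σ Bool λ b → ⨁ (F b) ≡ x
    to-family _ (inj₁ x≡) = true  , sym x≡
    to-family _ (inj₂ x≡) = false , sym x≡
    from-family : ∀ x → (Σ Bool λ b → ⨁ (F b) ≡ x) → pair (⨁ P) (⨁ P') x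
    from-family _ (true  , ≡x) = inj₁ (sym ≡x)
    from-family _ (false , ≡x) = inj₂ (sym ≡x)
    to-union : ∀ x → (Σ Bool λ b → F b x) → P x ⊎ P' x
    to-union _ (true  , p) = inj₁ p
    to-union _ (false , p) = inj₂ p
    from-union : ∀ x → P x ⊎ P' x → Σ Bool λ b → F b x
    from-union _ (inj₁ p) = true  , p
    from-union _ (inj₂ p) = false , p

  ≤ₑ-refl : ∀ a → a ≤ₑ a
  ≤ₑ-refl a = trans (⨁-ext (λ _ → λ { (inj₁ p) → p ; (inj₂ p) → p }) (λ _ → inj₁)) (⨁-single a)

  -- Transitivity: ⨁{a,c} = ⨁{a,b,c} = c, regrouping the three-element join.
  ≤ₑ-trans : ∀ {a b c} → a ≤ₑ b → b ≤ₑ c → a ≤ₑ c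
  ≤ₑ-trans {a} {b} {c} a≤b b≤c = begin
      ⨁ (pair a c)
    ≡⟨ cong₂ (λ u v → ⨁ (pair u v)) (sym (⨁-single a)) (sym b≤c) ⟩
      ⨁ (pair (⨁ (singleton a)) (⨁ (pair b c)))
    ≡⟨ ⨁-pair-⨁ (singleton a) (pair b c) ⟩
      ⨁ (λ x → singleton a x ⊎ pair b c x)
    ≡⟨ ⨁-ext regroup ungroup ⟩
      ⨁ (λ x → pair a b x ⊎ singleton c x)
    ≡⟨ sym (⨁-pair-⨁ (pair a b) (singleton c)) ⟩
      ⨁ (pair (⨁ (pair a b)) (⨁ (singleton c)))
    ≡⟨ cong₂ (λ u v → ⨁ (pair u v)) a≤b (⨁-single c) ⟩
      ⨁ (pair b c)
    ≡⟨ b≤c ⟩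
      c ∎
    where
    regroup : ∀ x → singleton a x ⊎ pair b c x → pair a b x ⊎ singleton c x
    regroup _ (inj₁ p)        = inj₁ (inj₁ p)
    regroup _ (inj₂ (inj₁ p)) = inj₁ (inj₂ p)
    regroup _ (inj₂ (inj₂ p)) = inj₂ p
    ungroup : ∀ x → pair a b x ⊎ singleton c x → singleton a x ⊎ pair b c x
    ungroup _ (inj₁ (inj₁ p)) = inj₁ p
    ungroup _ (inj₁ (inj₂ p)) = inj₂ (inj₁ p)
    ungroup _ (inj₂ p)        = inj₂ (inj₂ p)

  -- 𝟏 = ⨁ E is the top element.
  ≤ₑ-𝟏 : ∀ a → a ≤ₑ 𝟏
  ≤ₑ-𝟏 a = begin
      ⨁ (pair a 𝟏)
    ≡⟨ cong₂ (λ u v → ⨁ (pair u v)) (sym (⨁-single a)) (sym ⨁-full) ⟩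
      ⨁ (pair (⨁ (singleton a)) (⨁ (λ _ → Unit.⊤)))
    ≡⟨ ⨁-pair-⨁ (singleton a) (λ _ → Unit.⊤) ⟩
      ⨁ (λ x → singleton a x ⊎ Unit.⊤)
    ≡⟨ ⨁-ext (λ _ _ → Unit.tt) (λ _ _ → inj₂ Unit.tt) ⟩
      ⨁ (λ _ → Unit.⊤)
    ≡⟨ ⨁-full ⟩
      𝟏 ∎

  ⊗-distrib-pair : ∀ e a b → ⨁ (pair (e ⊗ a) (e ⊗ b)) ≡ e ⊗ ⨁ (pair a b)
  ⊗-distrib-pair e a b = trans (⨁-ext image preimage) (sym (⊗-distrib e (pair a b)))
    where
    image : ∀ x → pair (e ⊗ a) (e ⊗ b) x → Σ E λ y → pair a b y × e ⊗ y ≡ x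
    image _ (inj₁ x≡) = a , inj₁ refl , sym x≡
    image _ (inj₂ x≡) = b , inj₂ refl , sym x≡
    preimage : ∀ x → (Σ E λ y → pair a b y × e ⊗ y ≡ x) → pair (e ⊗ a) (e ⊗ b) x
    preimage _ (_ , inj₁ refl , ≡x) = inj₁ (sym ≡x)
    preimage _ (_ , inj₂ refl , ≡x) = inj₂ (sym ≡x)

  ⊗-monoʳ : ∀ e {a b} → a ≤ₑ b → (e ⊗ a) ≤ₑ (e ⊗ b)
  ⊗-monoʳ e {a} {b} a≤b = trans (⊗-distrib-pair e a b) (cong (e ⊗_) a≤b)

  -- Multiplying can only decrease: e ⊗ e' ≤ e ⊗ 𝟏 = e.
  ⊗-deflationaryˡ : ∀ e e' → (e ⊗ e') ≤ₑ e
  ⊗-deflationaryˡ e e' = subst ((e ⊗ e') ≤ₑ_) (⊗-one e) (⊗-monoʳ e (≤ₑ-𝟏 e'))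

  ⊗-deflationaryʳ : ∀ e e' → (e ⊗ e') ≤ₑ e'
  ⊗-deflationaryʳ e e' = subst (_≤ₑ e') (⊗-comm e' e) (⊗-deflationaryˡ e' e)

module _ (S : CSemiring) (C : CAS) where
  open CSemiring S
  open CSemiringOrder S

  ⨂-antitone : ∀ {n} {J J' : Subset n} (t : Fin n → E) → J ⊆ J' → ⨂ S C J' t ≤ₑ ⨂ S C J t
  ⨂-antitone {J = []}          {[]}           t _ = ≤ₑ-refl _
  ⨂-antitone {J = true  ∷ J}   {true  ∷ J'}   t s = ⊗-monoʳ (t zero) (⨂-antitone (λ i → t (suc i)) (drop-∷-⊆ s))
  ⨂-antitone {J = false ∷ J}   {true  ∷ J'}   t s =
    ≤ₑ-trans (⊗-deflationaryʳ (t zero) _) (⨂-antitone (λ i → t (suc i)) (drop-∷-⊆ s))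
  ⨂-antitone {J = false ∷ J}   {false ∷ J'}   t s = ⨂-antitone (λ i → t (suc i)) (drop-∷-⊆ s)
  ⨂-antitone {J = true  ∷ J}   {false ∷ J'}   t s with s here
  ... | ()

  suspect-upward : ∀ k (A : Fin (suc k) → SCA S C) σ → UpwardClosed (Suspect S C k A σ)
  suspect-upward k A σ J⊆J' J-susp = ≤ₑ-trans (⨂-antitone _ J⊆J') J-susp

theorem1 : (S : CSemiring) (C : CAS) (k : ℕ) (A : Fin (suc k) → SCA S C) →
           (∀ i → FiniteSCA S C (A i)) →
           (σ : Stream S C) → EventuallyPeriodic S C σ → InL S C (⋈[_] S C k A) σ →
           Suspect S C k A σ ⊤ →
           CSemiring._<ₑ_ S (diag S C (⋈[_] S C k A) σ) (CSemiring.𝟏 S) →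
           ∀ J → (FindSuspect (Suspect S C k A σ) ⊤ J → MinimalSuspect (Suspect S C k A σ) J)
               × (MinimalSuspect (Suspect S C k A σ) J → FindSuspect (Suspect S C k A σ) ⊤ J)
theorem1 S C k A _ σ _ _ ⊤-susp _ J =
    (λ found → proj₁ (sound ∣ ⊤ {suc k} ∣ ⊤ ℕ.≤-refl ⊤-susp found))
  , (λ J-minimal → complete ∣ ⊤ {suc k} ∣ ⊤ ℕ.≤-refl J-minimal ⊆⊤)
  where open FindSuspectCorrectness (Suspect S C k A σ) (suspect-upward S C k A σ)
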